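{- Let $p$ be a prime number and let $G$ be a finite, simple, undirected, connected graph. Then $G$ is zero-forcing for the cyclic group $\mathbb{Z}_p$ if and only if $G$ has at least $p$ vertices.
   Context: For a finite abelian group $(\mathcal G,+,0)$, a $\mathcal G$-labeling of a graph $G$ is a map $\ell: V(G)\to\mathcal G$, extended to vertex sets by $\ell(A)=\sum_{x\in A}\ell(x)$. A set $A\subseteq V(G)$ is called connected if the induced subgraph $G[A]$ is connected. The labeled graph $(G,\ell)$ is zero-avoiding if $\ell(A)\neq 0$ for every non-empty connected $A\subseteq V(G)$. The graph $G$ is zero-forcing for $\mathcal G$ if there is no $\mathcal G$-labeling $\ell$ of $G$ such that $(G,\ell)$ is zero-avoiding. $\mathbb{Z}_p$ denotes the integers modulo $p$. -}

module Defs where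

open import Data.Nat using (ℕ; zero; suc; _+_)
open import Data.Nat.Divisibility using (_∣_)
open import Data.Fin using (Fin; toℕ)
open import Data.Fin.Subset using (Subset; _∈_; Nonempty; ⊤)
open import Data.List using (List; []; _∷_; map; filter)
open import Data.Nat.ListAction using (sum)
open import Data.List.Base using ()
open import Data.Fin.Base using ()
open import Data.Vec.Functional using ()
open import Data.Product using (Σ; _×_; ∃; _,_)
open import Relation.Nullary using (¬_)
open import Relation.Binary.PropositionalEquality using (_≡_)
open import Data.Fin.Subset.Properties using (_∈?_)
open import Data.List using (allFin)
open import Level using (0ℓ)

record Graph (n : ℕ) : Set₁ where
  field
    Adj       : Fin n → Fin n → Set
    irrefl    : ∀ x → ¬ Adj x x
    sym       : ∀ {x y} → Adj x y → Adj y x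

open Graph public

data WalkIn {n : ℕ} (G : Graph n) (A : Subset n) : Fin n → Fin n → Set where
  here : ∀ {x} → x ∈ A → WalkIn G A x x
  step : ∀ {x y z} → x ∈ A → Adj G x y → WalkIn G A y z → WalkIn G A x z

ConnectedSet : {n : ℕ} → Graph n → Subset n → Set
ConnectedSet G A = ∀ {x y} → x ∈ A → y ∈ A → WalkIn G A x y

Connected : {n : ℕ} → Graph n → Set
Connected {n} G = ConnectedSet G ⊤

-- Z_p-labeling: labels are residues Fin p (representatives 0..p-1).
Labeling : ℕ → ℕ → Set
Labeling n p = Fin n → Fin p

-- The natural-number sum of representatives of the labels of vertices in A;
-- ℓ(A) = 0 in Z_p iff p divides this sum.
labelSum : {n p : ℕ} → Labeling n p → Subset n → ℕ
labelSum {n} ℓ A = sum (map (λ x → toℕ (ℓ x)) (filter (_∈? A) (allFin n)))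

ZeroAvoiding : {n p : ℕ} → Graph n → Labeling n p → Set
ZeroAvoiding {n} {p} G ℓ =
  ∀ (A : Subset n) → Nonempty A → ConnectedSet G A → ¬ (p ∣ labelSum ℓ A)

ZeroForcing : {n : ℕ} → Graph n → (p : ℕ) → Set
ZeroForcing {n} G p = ¬ (Σ (Labeling n p) λ ℓ → ZeroAvoiding G ℓ)

-- For a tree T rooted at r let R(T) ⊆ ℤₚ be the set of weights ℓ(A) of the connected vertex
-- sets A ∋ r of T; zero-avoidance says 0 ∉ R(T).  Hanging a rooted tree U below the root of T
-- gives a tree whose root-sums contain R(T) + ({0} ∪ R(U)), so the Cauchy–Davenport inequality
-- ∣X + Y∣ ≥ min(p, ∣X∣ + ∣Y∣ − 1) yields ∣R(T)∣ ≥ min(p, ∣V(T)∣) by induction, where 0 ∉ R(U)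
-- makes ∣{0} ∪ R(U)∣ = 1 + ∣R(U)∣.  A spanning tree of a connected graph with n ≥ p vertices
-- would then have every residue, 0 included, as a root-sum.  Conversely, for n < p the
-- labeling by 1 gives a nonempty A the weight ∣A∣ ∈ [1, n].
module Submission where

open import Algebra.Bundles using (AbelianGroup; CommutativeMonoid)
import Algebra.Definitions.RawMonoid as RawMonoidDefinitions
import Algebra.Properties.CommutativeSemigroup as CommutativeSemigroupProperties
import Algebra.Properties.Group as GroupProperties
import Algebra.Properties.Monoid.Mult as MonoidMultProperties
open import Data.Bool.Base using (if_then_else_)
open import Data.Fin.Base as Fin using (Fin; toℕ; fromℕ<; punchOut)
open import Data.Fin.Permutation using (Permutation′; permutation; _⟨$⟩ʳ_)
open import Data.Fin.Properties
  using (any?; _≟_; pigeonhole; punchOut-injective; <⇒≢; <-cmp; toℕ-fromℕ<; toℕ-injective; toℕ<n)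
open import Data.Fin.Subset
open import Data.Fin.Subset.Properties
open import Data.List.Base using (List; []; _∷_; map; filter; length; allFin)
open import Data.List.Membership.Propositional.Properties using (∈-filter⁺; ∈-allFin; ∈-length)
open import Data.List.Properties using (filter-accept; filter-reject; length-filter; length-tabulate)
open import Data.Nat.Base
  using (ℕ; zero; suc; _+_; _*_; _∸_; _≤_; _<_; _⊓_; NonZero; >-nonZero; >-nonZero⁻¹; nonTrivial⇒n>1)
open import Data.Nat.DivMod using (_%_; m%n<n; %-distribˡ-+; m<n⇒m%n≡m; n%n≡0)
open import Data.Nat.Divisibility using (_∣_; m%n≡0⇒n∣m; n∣m⇒m%n≡0; ∣⇒≤)
open import Data.Nat.ListAction using (sum)
open import Data.Nat.Primality using (Prime; euclidsLemma; prime⇒nonZero; prime⇒nonTrivial)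
open import Data.Nat.Properties
  using (module ≤-Reasoning; _≤?_; ≰⇒>; ≤-refl; ≤-reflexive; ≤-trans; ≤-antisym; ≤-total; ≤-pred;
         <⇒≤; <⇒≱; <-≤-trans; ≤-<-trans; n<1+n; +-suc; +-comm; +-assoc; +-identityʳ;
         +-mono-≤; +-monoʳ-≤; m≤m+n; m≤n+m; m+[n∸m]≡n; m+n∸n≡m; m∸n≤m; m<n⇒0<n∸m; ∸-monoˡ-≤;
         m⊓n≤m; m⊓n≤n; ⊓-glb; m≤n⇒m⊓n≡m; m≥n⇒m⊓n≡n; +-0-commutativeMonoid; +-commutativeSemigroup)
open import Data.Product.Base using (_×_; _,_; ∃; ∃₂; proj₂)
open import Data.Sum.Base as Sum using (inj₁; inj₂)
open import Data.Vec.Base using ([]; _∷_; lookup; tabulate)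
open import Data.Vec.Properties using (lookup∘tabulate; []=⇒lookup; lookup⇒[]=)
open import Function.Base using (_∘_; id)
open import Function.Bundles using (_⇔_; mk⇔)
open import Level using (0ℓ)
open import Relation.Binary.Definitions using (tri<; tri≈; tri>)
open import Relation.Binary.PropositionalEquality hiding ([_])
open import Relation.Nullary.Decidable using (Dec; yes; no; does; _×-dec_; ¬?; decidable-stable)
open import Relation.Nullary.Negation using (¬_; contradiction)
open import Relation.Unary using (Pred; Decidable)
open import Algebra.Properties.CommutativeMonoid.Sum +-0-commutativeMonoid
  using (sum-cong-≗; sum-permute) renaming (sum to ∑)
open import Algebra.Properties.CommutativeSemigroup +-commutativeSemigroup using (x∙yz≈y∙xz)

open import Defs renaming (sym to Adj-sym)

private variable
  n : ℕ
  A B V W : Subset n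
  a b r u w x y z : Fin n

⊓-+-mono : ∀ p {a b x y} → p ⊓ a ≤ x → p ⊓ b ≤ y → p ⊓ (a + b) ≤ p ⊓ (x + y)
⊓-+-mono p {a} {b} {x} {y} p⊓a≤x p⊓b≤y = ⊓-glb (m⊓n≤m p (a + b)) p⊓[a+b]≤x+y
  where
  p⊓[a+b]≤x+y : p ⊓ (a + b) ≤ x + y
  p⊓[a+b]≤x+y with ≤-total p a | ≤-total p b
  ... | inj₁ p≤a | _        = ≤-trans (m⊓n≤m p _) (≤-trans (subst (_≤ x) (m≤n⇒m⊓n≡m p≤a) p⊓a≤x) (m≤m+n x y))
  ... | inj₂ _   | inj₁ p≤b = ≤-trans (m⊓n≤m p _) (≤-trans (subst (_≤ y) (m≤n⇒m⊓n≡m p≤b) p⊓b≤y) (m≤n+m y x))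
  ... | inj₂ a≤p | inj₂ b≤p = ≤-trans (m⊓n≤n p _)
      (+-mono-≤ (subst (_≤ x) (m≥n⇒m⊓n≡n a≤p) p⊓a≤x) (subst (_≤ y) (m≥n⇒m⊓n≡n b≤p) p⊓b≤y))

-- Finite subsets

⟪_⟫ : {P : Pred (Fin n) 0ℓ} → Decidable P → Subset n
⟪ P? ⟫ = tabulate (does ∘ P?)

module _ {P : Pred (Fin n) 0ℓ} (P? : Decidable P) {x : Fin n} where

  ∈⟪⟫⁺ : P x → x ∈ ⟪ P? ⟫
  ∈⟪⟫⁺ px with P? x in eq
  ... | yes _  = lookup⇒[]= x _ (trans (lookup∘tabulate _ x) (cong does eq))
  ... | no ¬px = contradiction px ¬px

  ∈⟪⟫⁻ : x ∈ ⟪ P? ⟫ → P x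
  ∈⟪⟫⁻ x∈ with P? x in eq
  ... | yes px = px
  ... | no _ with () ← trans (sym (trans (lookup∘tabulate _ x) (cong does eq))) ([]=⇒lookup x∈)

preimage : (Fin n → Fin n) → Subset n → Subset n
preimage f A = tabulate (lookup A ∘ f)

∈-preimage⁺ : ∀ f → f x ∈ A → x ∈ preimage f A
∈-preimage⁺ {x = x} f fx∈A = lookup⇒[]= x _ (trans (lookup∘tabulate _ x) ([]=⇒lookup fx∈A))

∈-preimage⁻ : ∀ f → x ∈ preimage f A → f x ∈ A
∈-preimage⁻ {x = x} {A = A} f x∈ = lookup⇒[]= (f x) A (trans (sym (lookup∘tabulate _ x)) ([]=⇒lookup x∈))

∣preimage∣ : ∀ (π : Permutation′ n) A → ∣ preimage (π ⟨$⟩ʳ_) A ∣ ≡ ∣ A ∣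
∣preimage∣ π A = begin
  ∣ preimage (π ⟨$⟩ʳ_) A ∣        ≡⟨ ∣A∣≡∑χ (preimage (π ⟨$⟩ʳ_) A) ⟩
  ∑ (χ (preimage (π ⟨$⟩ʳ_) A))    ≡⟨ sum-cong-≗ (cong indicator ∘ lookup∘tabulate (lookup A ∘ (π ⟨$⟩ʳ_))) ⟩
  ∑ (χ A ∘ (π ⟨$⟩ʳ_))             ≡⟨ sum-permute (χ A) π ⟨
  ∑ (χ A)                         ≡⟨ ∣A∣≡∑χ A ⟨
  ∣ A ∣                           ∎
  where
  open ≡-Reasoning
  indicator : Side → ℕ
  indicator s = if s then 1 else 0
  χ : ∀ {n} → Subset n → Fin n → ℕ
  χ A = indicator ∘ lookup A
  ∣A∣≡∑χ : ∀ {n} (A : Subset n) → ∣ A ∣ ≡ ∑ (χ A)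
  ∣A∣≡∑χ []            = refl
  ∣A∣≡∑χ (inside ∷ A)  = cong suc (∣A∣≡∑χ A)
  ∣A∣≡∑χ (outside ∷ A) = ∣A∣≡∑χ A

∣p∪q∣+∣p∩q∣≡∣p∣+∣q∣ : ∀ (A B : Subset n) → ∣ A ∪ B ∣ + ∣ A ∩ B ∣ ≡ ∣ A ∣ + ∣ B ∣
∣p∪q∣+∣p∩q∣≡∣p∣+∣q∣ []            []            = refl
∣p∪q∣+∣p∩q∣≡∣p∣+∣q∣ (inside ∷ A)  (inside ∷ B)  =
  cong suc (trans (+-suc _ _) (trans (cong suc (∣p∪q∣+∣p∩q∣≡∣p∣+∣q∣ A B)) (sym (+-suc _ _))))
∣p∪q∣+∣p∩q∣≡∣p∣+∣q∣ (inside ∷ A)  (outside ∷ B) = cong suc (∣p∪q∣+∣p∩q∣≡∣p∣+∣q∣ A B)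
∣p∪q∣+∣p∩q∣≡∣p∣+∣q∣ (outside ∷ A) (inside ∷ B)  =
  trans (cong suc (∣p∪q∣+∣p∩q∣≡∣p∣+∣q∣ A B)) (sym (+-suc _ _))
∣p∪q∣+∣p∩q∣≡∣p∣+∣q∣ (outside ∷ A) (outside ∷ B) = ∣p∪q∣+∣p∩q∣≡∣p∣+∣q∣ A B

disjoint⁺ : (∀ {x} → x ∈ A → x ∉ B) → Empty (A ∩ B)
disjoint⁺ {A = A} {B} A∌B (x , x∈A∩B) = let x∈A , x∈B = x∈p∩q⁻ A B x∈A∩B in A∌B x∈A x∈B

disjoint⁻ : Empty (A ∩ B) → x ∈ A → x ∉ B
disjoint⁻ A∩B=∅ x∈A x∈B = A∩B=∅ (_ , x∈p∩q⁺ (x∈A , x∈B))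

disjoint-⁅⁆ : x ∉ A → Empty (A ∩ ⁅ x ⁆)
disjoint-⁅⁆ {x = x} {A} x∉A = disjoint⁺ λ y∈A y∈⁅x⁆ → x∉A (subst (_∈ A) (x∈⁅y⁆⇒x≡y x y∈⁅x⁆) y∈A)

∣p∪q∣≡∣p∣+∣q∣ : Empty (A ∩ B) → ∣ A ∪ B ∣ ≡ ∣ A ∣ + ∣ B ∣
∣p∪q∣≡∣p∣+∣q∣ {n} {A} {B} A∩B=∅ = begin
  ∣ A ∪ B ∣                ≡⟨ +-identityʳ ∣ A ∪ B ∣ ⟨
  ∣ A ∪ B ∣ + 0            ≡⟨ cong (∣ A ∪ B ∣ +_) (∣⊥∣≡0 n) ⟨
  ∣ A ∪ B ∣ + ∣ ⊥ {n} ∣    ≡⟨ cong (λ C → ∣ A ∪ B ∣ + ∣ C ∣) (Empty-unique A∩B=∅) ⟨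
  ∣ A ∪ B ∣ + ∣ A ∩ B ∣    ≡⟨ ∣p∪q∣+∣p∩q∣≡∣p∣+∣q∣ A B ⟩
  ∣ A ∣ + ∣ B ∣            ∎
  where open ≡-Reasoning

∣p∪⁅x⁆∣≡1+∣p∣ : x ∉ A → ∣ A ∪ ⁅ x ⁆ ∣ ≡ suc ∣ A ∣
∣p∪⁅x⁆∣≡1+∣p∣ {x = x} {A} x∉A =
  trans (∣p∪q∣≡∣p∣+∣q∣ (disjoint-⁅⁆ x∉A)) (trans (cong (∣ A ∣ +_) (∣⁅x⁆∣≡1 x)) (+-comm ∣ A ∣ 1))

injective⇒surjective : (f : Fin n → Fin n) → (∀ {i j} → f i ≡ f j → i ≡ j) → ∀ y → ∃ λ i → f i ≡ y
injective⇒surjective {suc n} f f-inj y with any? (λ i → f i ≟ y)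
... | yes hit  = hit
... | no  miss = collision (pigeonhole (n<1+n n) avoid-y)
  where
  avoid-y : Fin (suc n) → Fin n
  avoid-y i = punchOut {i = y} {j = f i} (λ y≡fᵢ → miss (i , sym y≡fᵢ))
  collision : (∃₂ λ i j → i Fin.< j × avoid-y i ≡ avoid-y j) → ∃ λ i → f i ≡ y
  collision (i , j , i<j , avoidᵢ≡avoidⱼ) =
    contradiction (f-inj (punchOut-injective {i = y} _ _ avoidᵢ≡avoidⱼ)) (<⇒≢ i<j)

-- The residues modulo p

module Modular (p : ℕ) ⦃ _ : NonZero p ⦄ where

  [_] : ℕ → Fin p
  [ m ] = fromℕ< (m%n<n m p)

  toℕ-[] : ∀ m → toℕ [ m ] ≡ m % p
  toℕ-[] m = toℕ-fromℕ< (m%n<n m p)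

  []-cong : ∀ {m n} → m % p ≡ n % p → [ m ] ≡ [ n ]
  []-cong {m} {n} eq = toℕ-injective (trans (toℕ-[] m) (trans eq (sym (toℕ-[] n))))

  []∘toℕ : ∀ x → [ toℕ x ] ≡ x
  []∘toℕ x = toℕ-injective (trans (toℕ-[] (toℕ x)) (m<n⇒m%n≡m (toℕ<n x)))

  infixl 6 _+ₚ_
  _+ₚ_ : Fin p → Fin p → Fin p
  x +ₚ y = [ toℕ x + toℕ y ]

  0ₚ : Fin p
  0ₚ = [ 0 ]

  -ₚ_ : Fin p → Fin p
  -ₚ x = [ p ∸ toℕ x ]

  0%p≡0 : 0 % p ≡ 0
  0%p≡0 = m<n⇒m%n≡m (>-nonZero⁻¹ p)

  []-homo-+ : ∀ m n → [ m + n ] ≡ [ m ] +ₚ [ n ]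
  []-homo-+ m n = []-cong (begin
    (m + n) % p                   ≡⟨ %-distribˡ-+ m n p ⟩
    (m % p + n % p) % p           ≡⟨ cong₂ (λ a b → (a + b) % p) (toℕ-[] m) (toℕ-[] n) ⟨
    (toℕ [ m ] + toℕ [ n ]) % p   ∎)
    where open ≡-Reasoning

  +ₚ-[]ʳ : ∀ x m → x +ₚ [ m ] ≡ [ toℕ x + m ]
  +ₚ-[]ʳ x m = trans (cong (_+ₚ [ m ]) (sym ([]∘toℕ x))) (sym ([]-homo-+ (toℕ x) m))

  +ₚ-[]ˡ : ∀ m x → [ m ] +ₚ x ≡ [ m + toℕ x ]
  +ₚ-[]ˡ m x = trans (cong ([ m ] +ₚ_) (sym ([]∘toℕ x))) (sym ([]-homo-+ m (toℕ x)))

  +ₚ-comm : ∀ x y → x +ₚ y ≡ y +ₚ x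
  +ₚ-comm x y = cong [_] (+-comm (toℕ x) (toℕ y))

  +ₚ-assoc : ∀ x y z → (x +ₚ y) +ₚ z ≡ x +ₚ (y +ₚ z)
  +ₚ-assoc x y z = begin
    [ toℕ x + toℕ y ] +ₚ z        ≡⟨ +ₚ-[]ˡ (toℕ x + toℕ y) z ⟩
    [ toℕ x + toℕ y + toℕ z ]     ≡⟨ cong [_] (+-assoc (toℕ x) (toℕ y) (toℕ z)) ⟩
    [ toℕ x + (toℕ y + toℕ z) ]   ≡⟨ +ₚ-[]ʳ x (toℕ y + toℕ z) ⟨
    x +ₚ [ toℕ y + toℕ z ]        ∎
    where open ≡-Reasoning

  +ₚ-identityˡ : ∀ x → 0ₚ +ₚ x ≡ x
  +ₚ-identityˡ x = trans (+ₚ-[]ˡ 0 x) ([]∘toℕ x)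

  +ₚ-identityʳ : ∀ x → x +ₚ 0ₚ ≡ x
  +ₚ-identityʳ x = trans (+ₚ-comm x 0ₚ) (+ₚ-identityˡ x)

  +ₚ-inverseʳ : ∀ x → x +ₚ (-ₚ x) ≡ 0ₚ
  +ₚ-inverseʳ x = begin
    x +ₚ [ p ∸ toℕ x ]        ≡⟨ +ₚ-[]ʳ x (p ∸ toℕ x) ⟩
    [ toℕ x + (p ∸ toℕ x) ]   ≡⟨ cong [_] (m+[n∸m]≡n (<⇒≤ (toℕ<n x))) ⟩
    [ p ]                     ≡⟨ []-cong (trans (n%n≡0 p) (sym 0%p≡0)) ⟩
    0ₚ                        ∎
    where open ≡-Reasoning

  +ₚ-inverseˡ : ∀ x → (-ₚ x) +ₚ x ≡ 0ₚ
  +ₚ-inverseˡ x = trans (+ₚ-comm (-ₚ x) x) (+ₚ-inverseʳ x)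

  +ₚ-abelianGroup : AbelianGroup 0ℓ 0ℓ
  +ₚ-abelianGroup = record
    { _≈_ = _≡_
    ; _∙_ = _+ₚ_
    ; ε   = 0ₚ
    ; _⁻¹ = -ₚ_
    ; isAbelianGroup = record
      { isGroup = record
        { isMonoid = record
          { isSemigroup = record
            { isMagma = record { isEquivalence = isEquivalence ; ∙-cong = cong₂ _+ₚ_ }
            ; assoc   = +ₚ-assoc
            }
          ; identity = +ₚ-identityˡ , +ₚ-identityʳ
          }
        ; inverse = +ₚ-inverseˡ , +ₚ-inverseʳ
        ; ⁻¹-cong = cong -ₚ_
        }
      ; comm = +ₚ-comm
      }
    }

  open AbelianGroup +ₚ-abelianGroup using (group; monoid; rawMonoid; commutativeMonoid)
  open CommutativeSemigroupProperties (CommutativeMonoid.commutativeSemigroup commutativeMonoid)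
    using (interchange) renaming (x∙yz≈y∙xz to +ₚ-x∙yz≈y∙xz)
  open GroupProperties group using (∙-cancelˡ; //-rightDividesˡ; //-rightDividesʳ; x∙y⁻¹≈ε⇒x≈y)
  open RawMonoidDefinitions rawMonoid using () renaming (_×_ to _·_)
  open MonoidMultProperties monoid using (×-homo-+)

  infixl 6 _-ₚ_
  _-ₚ_ : Fin p → Fin p → Fin p
  x -ₚ y = x +ₚ -ₚ y

  [x-y]+y≡x : ∀ x y → (x -ₚ y) +ₚ y ≡ x
  [x-y]+y≡x x y = //-rightDividesˡ y x

  [x+y]-y≡x : ∀ x y → (x +ₚ y) -ₚ y ≡ x
  [x+y]-y≡x x y = //-rightDividesʳ y x

  y+[x-y]≡x : ∀ x y → y +ₚ (x -ₚ y) ≡ x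
  y+[x-y]≡x x y = trans (+ₚ-comm y (x -ₚ y)) ([x-y]+y≡x x y)

  x-y≡0⇒x≡y : ∀ {x y} → x -ₚ y ≡ 0ₚ → x ≡ y
  x-y≡0⇒x≡y = x∙y⁻¹≈ε⇒x≈y _ _

  x+[y-z]≡y+[x-z] : ∀ x y z → x +ₚ (y -ₚ z) ≡ y +ₚ (x -ₚ z)
  x+[y-z]≡y+[x-z] x y z = +ₚ-x∙yz≈y∙xz x y (-ₚ z)

  [y+z]+[x-z]≡x+y : ∀ x y z → (y +ₚ z) +ₚ (x -ₚ z) ≡ x +ₚ y
  [y+z]+[x-z]≡x+y x y z = begin
    (y +ₚ z) +ₚ (x -ₚ z)   ≡⟨ interchange y z x (-ₚ z) ⟩
    (y +ₚ x) +ₚ (z -ₚ z)   ≡⟨ cong ((y +ₚ x) +ₚ_) (+ₚ-inverseʳ z) ⟩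
    (y +ₚ x) +ₚ 0ₚ         ≡⟨ +ₚ-identityʳ (y +ₚ x) ⟩
    y +ₚ x                 ≡⟨ +ₚ-comm y x ⟩
    x +ₚ y                 ∎
    where open ≡-Reasoning

  p∣⇒[]≡0ₚ : ∀ {m} → p ∣ m → [ m ] ≡ 0ₚ
  p∣⇒[]≡0ₚ {m} p∣m = []-cong (trans (n∣m⇒m%n≡0 m p p∣m) (sym 0%p≡0))

  []≡0ₚ⇒p∣ : ∀ {m} → [ m ] ≡ 0ₚ → p ∣ m
  []≡0ₚ⇒p∣ {m} [m]≡0 = m%n≡0⇒n∣m m p (begin
    m % p        ≡⟨ toℕ-[] m ⟨
    toℕ [ m ]    ≡⟨ cong toℕ [m]≡0 ⟩
    toℕ 0ₚ       ≡⟨ toℕ-[] 0 ⟩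
    0 % p        ≡⟨ 0%p≡0 ⟩
    0            ∎)
    where open ≡-Reasoning

  ·≡[*] : ∀ k x → k · x ≡ [ k * toℕ x ]
  ·≡[*] zero    x = refl
  ·≡[*] (suc k) x = trans (cong (x +ₚ_) (·≡[*] k x)) (+ₚ-[]ʳ x (k * toℕ x))

  module _ (p-prime : Prime p) {d : Fin p} (d≢0 : d ≢ 0ₚ) where

    ·≢0ₚ : ∀ {m} → 0 < m → m < p → m · d ≢ 0ₚ
    ·≢0ₚ {m} 0<m m<p m·d≡0 with euclidsLemma m (toℕ d) p-prime ([]≡0ₚ⇒p∣ (trans (sym (·≡[*] m d)) m·d≡0))
    ... | inj₁ p∣m = <⇒≱ m<p (∣⇒≤ ⦃ >-nonZero 0<m ⦄ p∣m)
    ... | inj₂ p∣d = d≢0 (trans (sym ([]∘toℕ d)) (p∣⇒[]≡0ₚ p∣d))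

    ·-distinct : ∀ {a b} → a < b → b < p → a · d ≢ b · d
    ·-distinct {a} {b} a<b b<p a·d≡b·d =
      ·≢0ₚ (m<n⇒0<n∸m a<b) (≤-<-trans (m∸n≤m b a) b<p) (sym (∙-cancelˡ (a · d) 0ₚ ((b ∸ a) · d) (begin
        a · d +ₚ 0ₚ            ≡⟨ +ₚ-identityʳ (a · d) ⟩
        a · d                  ≡⟨ a·d≡b·d ⟩
        b · d                  ≡⟨ cong (_· d) (m+[n∸m]≡n (<⇒≤ a<b)) ⟨
        (a + (b ∸ a)) · d      ≡⟨ ×-homo-+ d a (b ∸ a) ⟩
        a · d +ₚ (b ∸ a) · d   ∎)))
      where open ≡-Reasoning

    ·-cancelʳ : ∀ {i j : Fin p} → toℕ i · d ≡ toℕ j · d → i ≡ j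
    ·-cancelʳ {i} {j} eq with <-cmp i j
    ... | tri< i<j _ _ = contradiction eq (·-distinct i<j (toℕ<n j))
    ... | tri≈ _ i≡j _ = i≡j
    ... | tri> _ _ j<i = contradiction (sym eq) (·-distinct j<i (toℕ<n i))

    ·-surjective : ∀ y → ∃ λ k → k · d ≡ y
    ·-surjective y with k , k·d≡y ← injective⇒surjective (λ k → toℕ k · d) ·-cancelʳ y = toℕ k , k·d≡y

    closed⇒full : ∀ {A : Subset p} → (∀ {x} → x ∈ A → x +ₚ d ∈ A) → Nonempty A → ∀ y → y ∈ A
    closed⇒full {A} closed (a , a∈A) y with k , k·d≡y-a ← ·-surjective (y -ₚ a) =
      subst (_∈ A) (y+[x-y]≡x y a) (subst (λ z → a +ₚ z ∈ A) k·d≡y-a (+·-closed k a∈A))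
      where
      +·-closed : ∀ k {x} → x ∈ A → x +ₚ k · d ∈ A
      +·-closed zero        x∈A = subst (_∈ A) (sym (+ₚ-identityʳ _)) x∈A
      +·-closed (suc k) {x} x∈A = subst (_∈ A) (+ₚ-assoc x d (k · d)) (+·-closed k (closed x∈A))

-- Sumsets in ℤₚ and the Cauchy–Davenport inequality

module CauchyDavenport (p : ℕ) ⦃ _ : NonZero p ⦄ where

  open Modular p

  sumOf? : ∀ A B x → Dec (∃ λ a → a ∈ A × x -ₚ a ∈ B)
  sumOf? A B x = any? λ a → (a ∈? A) ×-dec (x -ₚ a ∈? B)

  infixl 6 _⊕_
  _⊕_ : Subset p → Subset p → Subset p
  A ⊕ B = ⟪ sumOf? A B ⟫

  ∈-⊕⁺ : ∀ {A B : Subset p} {a b} → a ∈ A → b ∈ B → a +ₚ b ∈ A ⊕ B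
  ∈-⊕⁺ {A} {B} {a} {b} a∈A b∈B =
    ∈⟪⟫⁺ (sumOf? A B) (a , a∈A , subst (_∈ B) (sym (trans (cong (_-ₚ a) (+ₚ-comm a b)) ([x+y]-y≡x b a))) b∈B)

  ∈-⊕⁻ : ∀ {A B : Subset p} {x} → x ∈ A ⊕ B → ∃₂ λ a b → a ∈ A × b ∈ B × a +ₚ b ≡ x
  ∈-⊕⁻ {A} {B} {x} x∈A⊕B with a , a∈A , x-a∈B ← ∈⟪⟫⁻ (sumOf? A B) x∈A⊕B =
    a , x -ₚ a , a∈A , x-a∈B , y+[x-y]≡x x a

  shift : Fin p → Permutation′ p
  shift e = permutation (_+ₚ e) (_-ₚ e) (λ y → [x-y]+y≡x y e) (λ x → [x+y]-y≡x x e)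

  infixl 6 _+ₛ_ _-ₛ_
  _+ₛ_ _-ₛ_ : Subset p → Fin p → Subset p
  A +ₛ e = preimage (_-ₚ e) A
  A -ₛ e = preimage (_+ₚ e) A

  ∣A+ₛe∣≡∣A∣ : ∀ A e → ∣ A +ₛ e ∣ ≡ ∣ A ∣
  ∣A+ₛe∣≡∣A∣ A e = ∣preimage∣ (shift (-ₚ e)) A

  dyson-∣∣ : ∀ A B e → ∣ A ∪ (B +ₛ e) ∣ + ∣ B ∩ (A -ₛ e) ∣ ≡ ∣ A ∣ + ∣ B ∣
  dyson-∣∣ A B e = begin
    ∣ A ∪ (B +ₛ e) ∣ + ∣ B ∩ (A -ₛ e) ∣   ≡⟨ cong (∣ A ∪ (B +ₛ e) ∣ +_) ∣B∩[A-e]∣≡∣A∩[B+e]∣ ⟩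
    ∣ A ∪ (B +ₛ e) ∣ + ∣ A ∩ (B +ₛ e) ∣   ≡⟨ ∣p∪q∣+∣p∩q∣≡∣p∣+∣q∣ A (B +ₛ e) ⟩
    ∣ A ∣ + ∣ B +ₛ e ∣                    ≡⟨ cong (∣ A ∣ +_) (∣A+ₛe∣≡∣A∣ B e) ⟩
    ∣ A ∣ + ∣ B ∣                         ∎
    where
    open ≡-Reasoning
    to : (B ∩ (A -ₛ e)) +ₛ e ⊆ A ∩ (B +ₛ e)
    to {x} x∈ with x-e∈B , x-e∈A-e ← x∈p∩q⁻ B (A -ₛ e) (∈-preimage⁻ (_-ₚ e) x∈) =
      x∈p∩q⁺ (subst (_∈ A) ([x-y]+y≡x x e) (∈-preimage⁻ (_+ₚ e) x-e∈A-e) , ∈-preimage⁺ {A = B} (_-ₚ e) x-e∈B)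
    from : A ∩ (B +ₛ e) ⊆ (B ∩ (A -ₛ e)) +ₛ e
    from {x} x∈ with x∈A , x∈B+e ← x∈p∩q⁻ A (B +ₛ e) x∈ =
      ∈-preimage⁺ {A = B ∩ (A -ₛ e)} (_-ₚ e) (x∈p∩q⁺ (∈-preimage⁻ (_-ₚ e) x∈B+e ,
        ∈-preimage⁺ {A = A} (_+ₚ e) (subst (_∈ A) (sym ([x-y]+y≡x x e)) x∈A)))
    ∣B∩[A-e]∣≡∣A∩[B+e]∣ : ∣ B ∩ (A -ₛ e) ∣ ≡ ∣ A ∩ (B +ₛ e) ∣
    ∣B∩[A-e]∣≡∣A∩[B+e]∣ = trans (sym (∣A+ₛe∣≡∣A∣ (B ∩ (A -ₛ e)) e)) (cong ∣_∣ (⊆-antisym to from))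

  dyson-⊆ : ∀ {A B : Subset p} e → (A ∪ (B +ₛ e)) ⊕ (B ∩ (A -ₛ e)) ⊆ A ⊕ B
  dyson-⊆ {A} {B} e x∈ with ∈-⊕⁻ x∈
  ... | a , b , a∈A′ , b∈B′ , refl with x∈p∩q⁻ B (A -ₛ e) b∈B′ | x∈p∪q⁻ A (B +ₛ e) a∈A′
  ... | b∈B , _    | inj₁ a∈A   = ∈-⊕⁺ a∈A b∈B
  ... | _ , b∈A-e  | inj₂ a∈B+e = subst (_∈ A ⊕ B) ([y+z]+[x-z]≡x+y a b e)
                                    (∈-⊕⁺ (∈-preimage⁻ (_+ₚ e) b∈A-e) (∈-preimage⁻ (_-ₚ e) a∈B+e))

  ∣A⊕B∣≡p : ∀ {A B : Subset p} → (∀ x → x ∈ A) → Nonempty B → ∣ A ⊕ B ∣ ≡ p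
  ∣A⊕B∣≡p {A} {B} all∈A (b , b∈B) = trans (cong ∣_∣ (⊆-antisym ⊆⊤ ⊤⊆A⊕B)) (∣⊤∣≡n p)
    where
    ⊤⊆A⊕B : ⊤ ⊆ A ⊕ B
    ⊤⊆A⊕B {x} _ = subst (_∈ A ⊕ B) ([x-y]+y≡x x b) (∈-⊕⁺ (all∈A (x -ₚ b)) b∈B)

  ∣A∣≤∣A⊕B∣ : ∀ {A B : Subset p} → Nonempty B → ∣ A ∣ ≤ ∣ A ⊕ B ∣
  ∣A∣≤∣A⊕B∣ {A} {B} (b , b∈B) = ≤-trans (≤-reflexive (sym (∣A+ₛe∣≡∣A∣ A b))) (p⊆q⇒∣p∣≤∣q∣ A+b⊆A⊕B)
    where
    A+b⊆A⊕B : A +ₛ b ⊆ A ⊕ B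
    A+b⊆A⊕B {x} x∈ = subst (_∈ A ⊕ B) ([x-y]+y≡x x b) (∈-⊕⁺ (∈-preimage⁻ (_-ₚ b) x∈) b∈B)

  dyson-shrinks : ∀ {A B : Subset p} {a b b′} → a ∈ A → b ∈ B → b′ ∈ B → b′ +ₚ (a -ₚ b) ∉ A →
                  b ∈ B ∩ (A -ₛ (a -ₚ b)) × B ∩ (A -ₛ (a -ₚ b)) ⊂ B
  dyson-shrinks {A} {B} {a} {b} {b′} a∈A b∈B b′∈B b′+e∉A =
    x∈p∩q⁺ (b∈B , ∈-preimage⁺ (_+ₚ e) (subst (_∈ A) (sym (y+[x-y]≡x a b)) a∈A)) ,
    (p∩q⊆p B (A -ₛ e) , b′ , b′∈B , λ b′∈B′ → b′+e∉A (∈-preimage⁻ (_+ₚ e) (proj₂ (x∈p∩q⁻ B _ b′∈B′))))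
    where
    e : Fin p
    e = a -ₚ b

  differences-closed⇒full : ∀ {A B : Subset p} {b₀ b₁} → Prime p →
    (∀ {x b b′} → x ∈ A → b ∈ B → b′ ∈ B → b′ +ₚ (x -ₚ b) ∈ A) →
    Nonempty A → b₀ ∈ B → b₁ ∈ B → b₁ ≢ b₀ → ∀ x → x ∈ A
  differences-closed⇒full {A} {B} {b₀} {b₁} p-prime closed A≢∅ b₀∈B b₁∈B b₁≢b₀ =
    closed⇒full p-prime (b₁≢b₀ ∘ x-y≡0⇒x≡y) +d-closed A≢∅
    where
    +d-closed : ∀ {x} → x ∈ A → x +ₚ (b₁ -ₚ b₀) ∈ A
    +d-closed {x} x∈A = subst (_∈ A) (sym (x+[y-z]≡y+[x-z] x b₁ b₀)) (closed x∈A b₀∈B b₁∈B)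

  ∣A∣+∣B∣∸1≤∣A⊕B∣ : ∀ {A B : Subset p} {b} → B ⊆ ⁅ b ⁆ → b ∈ B → ∣ A ∣ + ∣ B ∣ ∸ 1 ≤ ∣ A ⊕ B ∣
  ∣A∣+∣B∣∸1≤∣A⊕B∣ {A} {B} {b} B⊆⁅b⁆ b∈B = begin
    ∣ A ∣ + ∣ B ∣ ∸ 1        ≤⟨ ∸-monoˡ-≤ 1 (+-monoʳ-≤ ∣ A ∣ (p⊆q⇒∣p∣≤∣q∣ B⊆⁅b⁆)) ⟩
    ∣ A ∣ + ∣ ⁅ b ⁆ ∣ ∸ 1    ≡⟨ cong (λ m → ∣ A ∣ + m ∸ 1) (∣⁅x⁆∣≡1 b) ⟩
    ∣ A ∣ + 1 ∸ 1            ≡⟨ m+n∸n≡m ∣ A ∣ 1 ⟩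
    ∣ A ∣                    ≤⟨ ∣A∣≤∣A⊕B∣ (b , b∈B) ⟩
    ∣ A ⊕ B ∣                ∎
    where open ≤-Reasoning

  -- If b′ + (a − b) ∉ A for some a ∈ A and b, b′ ∈ B, Dyson's transform with
  -- e = a − b keeps ∣A∣ + ∣B∣, shrinks B and the sumset.  Otherwise A is closed under adding
  -- b₁ − b₀ for all b₀, b₁ ∈ B, so either A is all of ℤₚ or B is a singleton.
  cauchy-davenport : Prime p → ∀ {A B : Subset p} → Nonempty A → Nonempty B →
                     p ⊓ (∣ A ∣ + ∣ B ∣ ∸ 1) ≤ ∣ A ⊕ B ∣
  cauchy-davenport p-prime {B = B} = bounded ∣ B ∣ ≤-refl
    where
    bounded : ∀ k {A B : Subset p} → ∣ B ∣ ≤ k → Nonempty A → Nonempty B →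
              p ⊓ (∣ A ∣ + ∣ B ∣ ∸ 1) ≤ ∣ A ⊕ B ∣
    bounded zero ∣B∣≤0 _ (b , b∈B) = contradiction (≤-trans (x∈p⇒∣p-x∣<∣p∣ b∈B) ∣B∣≤0) λ ()
    bounded (suc k) {A} {B} ∣B∣≤1+k (a₀ , a₀∈A) (b₀ , b₀∈B)
      with any? (λ a → any? (λ b → any? (λ b′ →
             ((a ∈? A) ×-dec (b ∈? B)) ×-dec ((b′ ∈? B) ×-dec ¬? (b′ +ₚ (a -ₚ b) ∈? A)))))
    ... | yes (a , b , b′ , (a∈A , b∈B) , (b′∈B , b′+e∉A))
      with b∈B′ , B′⊂B ← dyson-shrinks a∈A b∈B b′∈B b′+e∉A = begin
      p ⊓ (∣ A ∣ + ∣ B ∣ ∸ 1)                            ≡⟨ cong (λ m → p ⊓ (m ∸ 1)) (dyson-∣∣ A B e) ⟨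
      p ⊓ (∣ A ∪ (B +ₛ e) ∣ + ∣ B ∩ (A -ₛ e) ∣ ∸ 1)      ≤⟨ bounded k ∣B′∣≤k A′≢∅ (b , b∈B′) ⟩
      ∣ (A ∪ (B +ₛ e)) ⊕ (B ∩ (A -ₛ e)) ∣                ≤⟨ p⊆q⇒∣p∣≤∣q∣ (dyson-⊆ e) ⟩
      ∣ A ⊕ B ∣                                          ∎
      where
      open ≤-Reasoning
      e : Fin p
      e = a -ₚ b
      A′≢∅ : Nonempty (A ∪ (B +ₛ e))
      A′≢∅ = a₀ , x∈p∪q⁺ (inj₁ a₀∈A)
      ∣B′∣≤k : ∣ B ∩ (A -ₛ e) ∣ ≤ k
      ∣B′∣≤k = ≤-pred (≤-trans (p⊂q⇒∣p∣<∣q∣ B′⊂B) ∣B∣≤1+k)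
    ... | no noEscape with any? (λ b₁ → (b₁ ∈? B) ×-dec ¬? (b₁ ≟ b₀))
    ... | yes (b₁ , b₁∈B , b₁≢b₀) = ≤-trans (m⊓n≤m p _) (≤-reflexive (sym (∣A⊕B∣≡p A-full (b₀ , b₀∈B))))
      where
      A-full : ∀ x → x ∈ A
      A-full = differences-closed⇒full p-prime
        (λ {x} {b} {b′} x∈A b∈B b′∈B → decidable-stable (_ ∈? A) λ ∉A →
          noEscape (x , b , b′ , (x∈A , b∈B) , (b′∈B , ∉A)))
        (a₀ , a₀∈A) b₀∈B b₁∈B b₁≢b₀
    ... | no onlyB₀ = ≤-trans (m⊓n≤n p _) (∣A∣+∣B∣∸1≤∣A⊕B∣ B⊆⁅b₀⁆ b₀∈B)
      where
      B⊆⁅b₀⁆ : B ⊆ ⁅ b₀ ⁆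
      B⊆⁅b₀⁆ {b} b∈B =
        subst (_∈ ⁅ b₀ ⁆) (sym (decidable-stable (b ≟ b₀) λ b≢b₀ → onlyB₀ (b , b∈B , b≢b₀))) (x∈⁅x⁆ b₀)

module _ (g : Fin n → ℕ) where

  sumOver : Subset n → List (Fin n) → ℕ
  sumOver A xs = sum (map g (filter (_∈? A) xs))

  sumOver-∪ : Empty (A ∩ B) → ∀ xs → sumOver (A ∪ B) xs ≡ sumOver A xs + sumOver B xs
  sumOver-∪ A∩B=∅ [] = refl
  sumOver-∪ {A} {B} A∩B=∅ (x ∷ xs) with x ∈? A | x ∈? B
  ... | yes x∈A | yes x∈B = contradiction x∈B (disjoint⁻ A∩B=∅ x∈A)
  ... | yes x∈A | no  _
    rewrite filter-accept (_∈? A ∪ B) {xs = xs} (x∈p∪q⁺ (inj₁ x∈A))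
    = trans (cong (g x +_) (sumOver-∪ A∩B=∅ xs)) (sym (+-assoc (g x) (sumOver A xs) (sumOver B xs)))
  ... | no  _   | yes x∈B
    rewrite filter-accept (_∈? A ∪ B) {xs = xs} (x∈p∪q⁺ (inj₂ x∈B))
    = trans (cong (g x +_) (sumOver-∪ A∩B=∅ xs)) (x∙yz≈y∙xz (g x) (sumOver A xs) (sumOver B xs))
  ... | no  x∉A | no  x∉B
    rewrite filter-reject (_∈? A ∪ B) {x = x} {xs = xs} (Sum.[ x∉A , x∉B ]′ ∘ x∈p∪q⁻ A B)
    = sumOver-∪ A∩B=∅ xs

  sum-map-ones : (∀ x → g x ≡ 1) → ∀ xs → sum (map g xs) ≡ length xs
  sum-map-ones g≡1 []       = refl
  sum-map-ones g≡1 (x ∷ xs) = cong₂ _+_ (g≡1 x) (sum-map-ones g≡1 xs)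

module _ {p : ℕ} (ℓ : Labeling n p) where

  labelSum-∪ : Empty (A ∩ B) → labelSum ℓ (A ∪ B) ≡ labelSum ℓ A + labelSum ℓ B
  labelSum-∪ A∩B=∅ = sumOver-∪ (toℕ ∘ ℓ) A∩B=∅ (allFin n)

  module _ (ℓ≡1 : ∀ x → toℕ (ℓ x) ≡ 1) where

    labelSum-ones : ∀ A → labelSum ℓ A ≡ length (filter (_∈? A) (allFin n))
    labelSum-ones A = sum-map-ones (toℕ ∘ ℓ) ℓ≡1 (filter (_∈? A) (allFin n))

    labelSum-ones-≤n : ∀ A → labelSum ℓ A ≤ n
    labelSum-ones-≤n A = ≤-trans (≤-reflexive (labelSum-ones A))
      (≤-trans (length-filter (_∈? A) (allFin n)) (≤-reflexive (length-tabulate id)))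

    0<labelSum-ones : Nonempty A → 0 < labelSum ℓ A
    0<labelSum-ones {A} (x , x∈A) =
      subst (0 <_) (sym (labelSum-ones A)) (∈-length (∈-filter⁺ (_∈? A) (∈-allFin x) x∈A))

-- Walks and rooted trees

module _ (G : Graph n) where

  WalkIn-mono : A ⊆ B → WalkIn G A x y → WalkIn G B x y
  WalkIn-mono A⊆B (here x∈A)          = here (A⊆B x∈A)
  WalkIn-mono A⊆B (step x∈A x~y walk) = step (A⊆B x∈A) x~y (WalkIn-mono A⊆B walk)

  WalkIn-++ : WalkIn G A x y → WalkIn G A y z → WalkIn G A x z
  WalkIn-++ (here _)            walk′ = walk′
  WalkIn-++ (step x∈A x~y walk) walk′ = step x∈A x~y (WalkIn-++ walk walk′)

  ⁅⁆-connected : ∀ v → ConnectedSet G ⁅ v ⁆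
  ⁅⁆-connected v x∈ y∈ with refl ← x∈⁅y⁆⇒x≡y v x∈ | refl ← x∈⁅y⁆⇒x≡y v y∈ = here x∈

  ∪-connected : ConnectedSet G A → ConnectedSet G B → a ∈ A → b ∈ B → Adj G a b → ConnectedSet G (A ∪ B)
  ∪-connected {A} {B} A-conn B-conn a∈A b∈B a~b x∈ y∈ with x∈p∪q⁻ A B x∈ | x∈p∪q⁻ A B y∈
  ... | inj₁ x∈A | inj₁ y∈A = WalkIn-mono (p⊆p∪q B) (A-conn x∈A y∈A)
  ... | inj₂ x∈B | inj₂ y∈B = WalkIn-mono (q⊆p∪q A B) (B-conn x∈B y∈B)
  ... | inj₁ x∈A | inj₂ y∈B = WalkIn-++ (WalkIn-mono (p⊆p∪q B) (A-conn x∈A a∈A))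
      (step (p⊆p∪q B a∈A) a~b (WalkIn-mono (q⊆p∪q A B) (B-conn b∈B y∈B)))
  ... | inj₂ x∈B | inj₁ y∈A = WalkIn-++ (WalkIn-mono (q⊆p∪q A B) (B-conn x∈B b∈B))
      (step (q⊆p∪q A B b∈B) (Adj-sym G a~b) (WalkIn-mono (p⊆p∪q B) (A-conn a∈A y∈A)))

  walk-exit : WalkIn G B x y → x ∈ A → y ∉ A → ∃₂ λ u w → u ∈ A × w ∉ A × Adj G u w
  walk-exit (here _) x∈A x∉A = contradiction x∈A x∉A
  walk-exit {A = A} (step {y = w} _ x~w walk) x∈A y∉A with w ∈? A
  ... | yes w∈A = walk-exit walk w∈A y∉A
  ... | no  w∉A = _ , w , x∈A , w∉A , x~w

  -- Trees are built by hanging a rooted tree (root s) below the root r of another; every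
  -- rooted tree arises this way, by splitting it at an edge r s leaving the root.
  data RootedTree : Subset n → Fin n → Set where
    leaf : ∀ r → RootedTree ⁅ r ⁆ r
    join : ∀ {V W r s} → RootedTree V r → RootedTree W s → Adj G r s → Empty (V ∩ W) →
           RootedTree (V ∪ W) r

  root∈ : RootedTree V r → r ∈ V
  root∈ (leaf r)       = x∈⁅x⁆ r
  root∈ (join T _ _ _) = x∈p∪q⁺ (inj₁ (root∈ T))

  grow : RootedTree V r → u ∈ V → w ∉ V → Adj G u w → RootedTree (V ∪ ⁅ w ⁆) r
  grow {w = w} (leaf r) u∈⁅r⁆ w∉⁅r⁆ u~w with refl ← x∈⁅y⁆⇒x≡y r u∈⁅r⁆ =
    join (leaf r) (leaf w) u~w (disjoint-⁅⁆ w∉⁅r⁆)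
  grow {w = w} (join {V} {W} {r} T U r~s V∩W=∅) u∈V∪W w∉V∪W u~w with x∈p∪q⁻ V W u∈V∪W
  ... | inj₁ u∈V = subst (λ X → RootedTree X r) [V∪w]∪W≡[V∪W]∪w
    (join (grow T u∈V (w∉V∪W ∘ p⊆p∪q W) u~w) U r~s (disjoint⁺ [V∪w]∌W))
    where
    [V∪w]∪W≡[V∪W]∪w : (V ∪ ⁅ w ⁆) ∪ W ≡ (V ∪ W) ∪ ⁅ w ⁆
    [V∪w]∪W≡[V∪W]∪w = trans (∪-assoc V ⁅ w ⁆ W) (trans (cong (V ∪_) (∪-comm ⁅ w ⁆ W)) (sym (∪-assoc V W ⁅ w ⁆)))
    [V∪w]∌W : ∀ {x} → x ∈ V ∪ ⁅ w ⁆ → x ∉ W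
    [V∪w]∌W x∈V∪w x∈W with x∈p∪q⁻ V ⁅ w ⁆ x∈V∪w
    ... | inj₁ x∈V   = disjoint⁻ V∩W=∅ x∈V x∈W
    ... | inj₂ x∈⁅w⁆ = w∉V∪W (q⊆p∪q V W (subst (_∈ W) (x∈⁅y⁆⇒x≡y w x∈⁅w⁆) x∈W))
  ... | inj₂ u∈W = subst (λ X → RootedTree X r) (sym (∪-assoc V W ⁅ w ⁆))
    (join T (grow U u∈W (w∉V∪W ∘ q⊆p∪q V W) u~w) r~s (disjoint⁺ V∌[W∪w]))
    where
    V∌[W∪w] : ∀ {x} → x ∈ V → x ∉ W ∪ ⁅ w ⁆
    V∌[W∪w] x∈V x∈W∪w with x∈p∪q⁻ W ⁅ w ⁆ x∈W∪w
    ... | inj₁ x∈W   = disjoint⁻ V∩W=∅ x∈V x∈W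
    ... | inj₂ x∈⁅w⁆ = w∉V∪W (p⊆p∪q W (subst (_∈ V) (x∈⁅y⁆⇒x≡y w x∈⁅w⁆) x∈V))

  spanningTree : Connected G → ∀ r → RootedTree ⊤ r
  spanningTree connected r = extend n (subst (n ≤_) (cong (n +_) (sym (∣⁅x⁆∣≡1 r))) (m≤m+n n 1)) (leaf r)
    where
    extend : ∀ k {V} → n ≤ k + ∣ V ∣ → RootedTree V r → RootedTree ⊤ r
    extend zero {V} n≤∣V∣ T = subst (λ X → RootedTree X r) (∣p∣≡n⇒p≡⊤ (≤-antisym (∣p∣≤n V) n≤∣V∣)) T
    extend (suc k) {V} n≤1+k+∣V∣ T with any? (λ z → ¬? (z ∈? V))
    ... | no  V-full = subst (λ X → RootedTree X r) (⊆-antisym ⊆⊤ ⊤⊆V) T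
      where
      ⊤⊆V : ⊤ ⊆ V
      ⊤⊆V {z} _ = decidable-stable (z ∈? V) λ z∉V → V-full (z , z∉V)
    ... | yes (z , z∉V) with u , w , u∈V , w∉V , u~w ← walk-exit (connected ∈⊤ ∈⊤) (root∈ T) z∉V =
      extend k (subst (n ≤_) fuel-moves n≤1+k+∣V∣) (grow T u∈V w∉V u~w)
      where
      fuel-moves : suc k + ∣ V ∣ ≡ k + ∣ V ∪ ⁅ w ⁆ ∣
      fuel-moves = trans (sym (+-suc k ∣ V ∣)) (cong (k +_) (sym (∣p∪⁅x⁆∣≡1+∣p∣ w∉V)))

module RootSums {p : ℕ} ⦃ _ : NonZero p ⦄ (G : Graph n) (ℓ : Labeling n p) where

  open Modular p
  open CauchyDavenport p

  weight : Subset n → Fin p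
  weight A = [ labelSum ℓ A ]

  weight-∪ : Empty (A ∩ B) → weight (A ∪ B) ≡ weight A +ₚ weight B
  weight-∪ {A} {B} A∩B=∅ = trans (cong [_] (labelSum-∪ ℓ A∩B=∅)) ([]-homo-+ (labelSum ℓ A) (labelSum ℓ B))

  -- For the join of T and U, a connected set through the root r is one through r in T,
  -- possibly together with one through the root of U.
  rootSums : RootedTree G V r → Subset p
  rootSums (leaf r)       = ⁅ weight ⁅ r ⁆ ⁆
  rootSums (join T U _ _) = rootSums T ⊕ (⁅ 0ₚ ⁆ ∪ rootSums U)

  RootedWeight : Subset n → Fin n → Fin p → Set
  RootedWeight V r x = ∃ λ A → A ⊆ V × r ∈ A × ConnectedSet G A × weight A ≡ x

  rootSums-sound : ∀ {x} (T : RootedTree G V r) → x ∈ rootSums T → RootedWeight V r x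
  rootSums-sound (leaf r) x∈ with refl ← x∈⁅y⁆⇒x≡y _ x∈ = ⁅ r ⁆ , id , x∈⁅x⁆ r , ⁅⁆-connected G r , refl
  rootSums-sound (join {V} {W} T U r~s V∩W=∅) x∈ with ∈-⊕⁻ x∈
  ... | y , z , y∈ , z∈ , refl with rootSums-sound T y∈ | x∈p∪q⁻ ⁅ 0ₚ ⁆ (rootSums U) z∈
  ... | A , A⊆V , r∈A , A-conn , refl | inj₁ z∈⁅0⁆ rewrite x∈⁅y⁆⇒x≡y 0ₚ z∈⁅0⁆ =
    A , p⊆p∪q W ∘ A⊆V , r∈A , A-conn , sym (+ₚ-identityʳ (weight A))
  ... | A , A⊆V , r∈A , A-conn , refl | inj₂ z∈Rᵤ with rootSums-sound U z∈Rᵤ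
  ... | B , B⊆W , s∈B , B-conn , refl =
    A ∪ B , x∈p∪q⁺ ∘ Sum.map A⊆V B⊆W ∘ x∈p∪q⁻ A B , x∈p∪q⁺ (inj₁ r∈A) ,
    ∪-connected G A-conn B-conn r∈A s∈B r~s ,
    weight-∪ (disjoint⁺ λ x∈A x∈B → disjoint⁻ V∩W=∅ (A⊆V x∈A) (B⊆W x∈B))

  rootSums-nonempty : (T : RootedTree G V r) → Nonempty (rootSums T)
  rootSums-nonempty (leaf r)       = weight ⁅ r ⁆ , x∈⁅x⁆ _
  rootSums-nonempty (join T _ _ _) with y , y∈ ← rootSums-nonempty T =
    y +ₚ 0ₚ , ∈-⊕⁺ y∈ (x∈p∪q⁺ (inj₁ (x∈⁅x⁆ 0ₚ)))

  module _ (avoiding : ZeroAvoiding G ℓ) where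

    0∉rootSums : (T : RootedTree G V r) → 0ₚ ∉ rootSums T
    0∉rootSums T 0∈ with A , _ , r∈A , A-conn , weight≡0 ← rootSums-sound T 0∈ =
      avoiding A (_ , r∈A) A-conn ([]≡0ₚ⇒p∣ weight≡0)

    rootSums-large : Prime p → (T : RootedTree G V r) → p ⊓ ∣ V ∣ ≤ ∣ rootSums T ∣
    rootSums-large p-prime (leaf r) =
      ≤-trans (m⊓n≤n p _) (≤-reflexive (trans (∣⁅x⁆∣≡1 r) (sym (∣⁅x⁆∣≡1 (weight ⁅ r ⁆)))))
    rootSums-large p-prime (join {V} {W} T U _ V∩W=∅) = begin
      p ⊓ ∣ V ∪ W ∣                        ≡⟨ cong (p ⊓_) (∣p∪q∣≡∣p∣+∣q∣ V∩W=∅) ⟩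
      p ⊓ (∣ V ∣ + ∣ W ∣)                  ≤⟨ ⊓-+-mono p IHₜ IHᵤ ⟩
      p ⊓ (∣ Rₜ ∣ + ∣ Rᵤ ∣)                 ≡⟨ cong (λ m → p ⊓ (m ∸ 1)) (+-suc ∣ Rₜ ∣ ∣ Rᵤ ∣) ⟨
      p ⊓ (∣ Rₜ ∣ + suc ∣ Rᵤ ∣ ∸ 1)         ≡⟨ cong (λ m → p ⊓ (∣ Rₜ ∣ + m ∸ 1)) ∣0∪Rᵤ∣≡1+∣Rᵤ∣ ⟨
      p ⊓ (∣ Rₜ ∣ + ∣ ⁅ 0ₚ ⁆ ∪ Rᵤ ∣ ∸ 1)    ≤⟨ cauchy-davenport p-prime (rootSums-nonempty T) (0ₚ , 0∈0∪Rᵤ) ⟩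
      ∣ Rₜ ⊕ (⁅ 0ₚ ⁆ ∪ Rᵤ) ∣               ∎
      where
      open ≤-Reasoning
      Rₜ Rᵤ : Subset p
      Rₜ = rootSums T
      Rᵤ = rootSums U
      IHₜ : p ⊓ ∣ V ∣ ≤ ∣ Rₜ ∣
      IHₜ = rootSums-large p-prime T
      IHᵤ : p ⊓ ∣ W ∣ ≤ ∣ Rᵤ ∣
      IHᵤ = rootSums-large p-prime U
      0∈0∪Rᵤ : 0ₚ ∈ ⁅ 0ₚ ⁆ ∪ Rᵤ
      0∈0∪Rᵤ = x∈p∪q⁺ (inj₁ (x∈⁅x⁆ 0ₚ))
      ∣0∪Rᵤ∣≡1+∣Rᵤ∣ : ∣ ⁅ 0ₚ ⁆ ∪ Rᵤ ∣ ≡ suc ∣ Rᵤ ∣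
      ∣0∪Rᵤ∣≡1+∣Rᵤ∣ = trans (cong ∣_∣ (∪-comm ⁅ 0ₚ ⁆ Rᵤ)) (∣p∪⁅x⁆∣≡1+∣p∣ (0∉rootSums U))

module _ {p : ℕ} (G : Graph n) (p-prime : Prime p) where

  private instance
    p≢0 : NonZero p
    p≢0 = prime⇒nonZero p-prime

  open Modular p using (0ₚ)

  large⇒zeroForcing : Connected G → p ≤ n → ZeroForcing G p
  large⇒zeroForcing connected p≤n (ℓ , avoiding) = 0∉rootSums avoiding T 0∈R
    where
    open RootSums G ℓ
    T : RootedTree G ⊤ (fromℕ< (<-≤-trans (>-nonZero⁻¹ p) p≤n))
    T = spanningTree G connected _
    R : Subset p
    R = rootSums T
    p≤∣R∣ : p ≤ ∣ R ∣
    p≤∣R∣ = subst (_≤ ∣ R ∣) (trans (cong (p ⊓_) (∣⊤∣≡n n)) (m≤n⇒m⊓n≡m p≤n)) (rootSums-large avoiding p-prime T)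
    0∈R : 0ₚ ∈ R
    0∈R = subst (0ₚ ∈_) (sym (∣p∣≡n⇒p≡⊤ (≤-antisym (∣p∣≤n R) p≤∣R∣))) ∈⊤

  small⇒¬zeroForcing : n < p → ¬ ZeroForcing G p
  small⇒¬zeroForcing n<p zeroForcing = zeroForcing (one , avoiding)
    where
    one : Labeling n p
    one _ = fromℕ< (nonTrivial⇒n>1 p ⦃ prime⇒nonTrivial p-prime ⦄)
    one≡1 : ∀ x → toℕ (one x) ≡ 1
    one≡1 _ = toℕ-fromℕ< _
    avoiding : ZeroAvoiding G one
    avoiding A A≢∅ _ p∣ = <⇒≱ (≤-<-trans (labelSum-ones-≤n one one≡1 A) n<p)
                                (∣⇒≤ ⦃ >-nonZero (0<labelSum-ones one one≡1 A≢∅) ⦄ p∣)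

theorem1p1 : (p : ℕ) → Prime p → (n : ℕ) → (G : Graph n) → Connected G →
    (ZeroForcing G p ⇔ p ≤ n)
theorem1p1 p p-prime n G connected = mk⇔
  (λ zeroForcing → decidable-stable (p ≤? n) λ p≰n → small⇒¬zeroForcing G p-prime (≰⇒> p≰n) zeroForcing)
  (large⇒zeroForcing G p-prime connected)
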